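{- If $G$ is a well-covered graph with no isolatable vertices, then $G \Box K_2$ is well-covered.
   Context: All graphs are finite and simple. A graph is well-covered if all its maximal independent sets have the same cardinality. A vertex $w$ of a graph $X$ is isolatable in $X$ if there exists an independent set $J$ of $X$ such that $V(X)-N[J]=\{w\}$, where $N[J]$ is $J$ together with all vertices adjacent to some vertex of $J$. The Cartesian product $G \Box K_2$ has vertex set $V(G)\times\{1,2\}$, with $(g_1,i)$ adjacent to $(g_2,j)$ if either $g_1=g_2$ and $i\neq j$, or $i=j$ and $g_1g_2\in E(G)$. -}

module Defs where

open import Data.Nat using (ℕ; _+_)
open import Data.Fin using (Fin; splitAt)
open import Data.Fin.Subset using (Subset; _∈_; _∉_; _⊆_; ∣_∣)
open import Data.Product using (Σ; ∃; _×_; _,_)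
open import Data.Sum using (_⊎_; inj₁; inj₂)
open import Data.Empty using (⊥)
open import Relation.Nullary using (¬_)
open import Relation.Binary.PropositionalEquality using (_≡_)
open import Level using (0ℓ)

record Graph : Set₁ where
  field
    n     : ℕ
    Adj   : Fin n → Fin n → Set
    irrefl : ∀ v → ¬ Adj v v
    sym    : ∀ u v → Adj u v → Adj v u
open Graph public

Independent : (G : Graph) → Subset (n G) → Set
Independent G S = ∀ u v → u ∈ S → v ∈ S → ¬ Adj G u v

MaximalIndependent : (G : Graph) → Subset (n G) → Set
MaximalIndependent G S =
  Independent G S × (∀ T → Independent G T → S ⊆ T → T ⊆ S)

WellCovered : Graph → Set
WellCovered G = ∀ S T → MaximalIndependent G S → MaximalIndependent G T → ∣ S ∣ ≡ ∣ T ∣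

InClosedNbhd : (G : Graph) → Subset (n G) → Fin (n G) → Set
InClosedNbhd G J v = v ∈ J ⊎ ∃ λ u → u ∈ J × Adj G u v

Isolatable : (G : Graph) → Fin (n G) → Set
Isolatable G w = Σ (Subset (n G)) λ J →
  Independent G J × (∀ v → (¬ InClosedNbhd G J v → v ≡ w) × (v ≡ w → ¬ InClosedNbhd G J v))

-- Adjacency of G □ K₂ on Fin (n + n): splitAt n v = inj₁ g means (g,1), inj₂ g means (g,2).
ProdAdj′ : (G : Graph) → Fin (n G) ⊎ Fin (n G) → Fin (n G) ⊎ Fin (n G) → Set
ProdAdj′ G (inj₁ a) (inj₁ b) = Adj G a b
ProdAdj′ G (inj₂ a) (inj₂ b) = Adj G a b
ProdAdj′ G (inj₁ a) (inj₂ b) = a ≡ b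
ProdAdj′ G (inj₂ a) (inj₁ b) = a ≡ b

prodIrrefl : (G : Graph) → ∀ x → ¬ ProdAdj′ G x x
prodIrrefl G (inj₁ a) = irrefl G a
prodIrrefl G (inj₂ a) = irrefl G a

prodSym : (G : Graph) → ∀ x y → ProdAdj′ G x y → ProdAdj′ G y x
prodSym G (inj₁ a) (inj₁ b) p = sym G a b p
prodSym G (inj₂ a) (inj₂ b) p = sym G a b p
prodSym G (inj₁ a) (inj₂ b) p = Relation.Binary.PropositionalEquality.sym p
prodSym G (inj₂ a) (inj₁ b) p = Relation.Binary.PropositionalEquality.sym p

_□K₂ : Graph → Graph
G □K₂ = record
  { n = n G + n G
  ; Adj = λ u v → ProdAdj′ G (splitAt (n G) u) (splitAt (n G) v)
  ; irrefl = λ v → prodIrrefl G (splitAt (n G) v)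
  ; sym = λ u v → prodSym G (splitAt (n G) u) (splitAt (n G) v)
  }

-- A maximal independent set S of G □ K₂ splits into its two layers A and B,
-- which are independent and disjoint.  Maximality of S says that every vertex
-- outside N[A] lies in B (and symmetrically).  If some v were outside N[A],
-- then J = A ∪ ((V − N[A]) − {v}) would be independent (V − N[A] ⊆ B) and
-- would leave exactly v undominated, so v would be isolatable.  Hence both
-- layers are dominating, so maximal in G, and |S| = |A| + |B| is the same for
-- every S because G is well-covered.  Adjacency in G need not be decidable,
-- but the conclusion is an equation of naturals, so we may assume it is.
module Submission where

open import Defs
open import Data.Nat using (suc; _+_; _≟_)
open import Data.Bool using (true; false)
open import Data.Empty using (⊥-elim)
open import Data.Fin using (Fin; splitAt; join)
open import Data.Fin.Properties using (any?; sequence; splitAt-join)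
  renaming (_≟_ to _≟ᶠ_)
open import Data.Fin.Subset using (Subset; _∈_; _∉_; _⊆_; ∣_∣; _∪_; ⁅_⁆)
open import Data.Fin.Subset.Properties using (_∈?_; p⊆p∪q; x∈p∪q⁺; x∈p∪q⁻; x∈⁅x⁆; x∈⁅y⁆⇒x≡y)
open import Data.Product using (_×_; _,_; proj₁; proj₂)
open import Data.Sum using (_⊎_; inj₁; inj₂; [_,_]′)
import Data.Sum as Sum
open import Data.Vec using ([]; _∷_; _++_; lookup; tabulate; take; drop)
open import Data.Vec.Properties using (lookup-splitAt; lookup⇒[]=; []=⇒lookup; lookup∘tabulate; take++drop≡id)
open import Effect.Monad using (RawMonad)
open import Function using (_∘_; id)
open import Relation.Binary.Definitions using (Decidable)
open import Relation.Binary.PropositionalEquality as Eq using (_≡_; _≢_; refl; trans; cong; cong₂; subst; subst₂)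
open import Relation.Nullary using (¬_; Dec; does)
open import Relation.Nullary.Decidable using (_⊎-dec_; _×-dec_; ¬?; dec-true; dec-false; decidable-stable; ¬¬-excluded-middle)
open import Relation.Nullary.Negation using (¬¬-Monad; ¬¬-map)

¬¬-decidable : ∀ {m k} (R : Fin m → Fin k → Set) → ¬ ¬ Decidable R
¬¬-decidable R = sequence ¬¬-applicative λ _ → sequence ¬¬-applicative λ _ → ¬¬-excluded-middle
  where ¬¬-applicative = RawMonad.rawApplicative ¬¬-Monad

module _ {m} {P : Fin m → Set} (P? : ∀ x → Dec (P x)) where

  fromDec : Subset m
  fromDec = tabulate (does ∘ P?)

  ∈-fromDec⁺ : ∀ {x} → P x → x ∈ fromDec
  ∈-fromDec⁺ {x} px = lookup⇒[]= x fromDec (trans (lookup∘tabulate (does ∘ P?) x) (dec-true (P? x) px))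

  ∈-fromDec⁻ : ∀ {x} → x ∈ fromDec → P x
  ∈-fromDec⁻ {x} x∈ = decidable-stable (P? x) λ ¬px →
    true≢false (trans (Eq.sym ([]=⇒lookup x∈)) (trans (lookup∘tabulate (does ∘ P?) x) (dec-false (P? x) ¬px)))
    where
    true≢false : true ≢ false
    true≢false ()

∣p++q∣≡∣p∣+∣q∣ : ∀ {m k} (p : Subset m) (q : Subset k) → ∣ p ++ q ∣ ≡ ∣ p ∣ + ∣ q ∣
∣p++q∣≡∣p∣+∣q∣ []          q = refl
∣p++q∣≡∣p∣+∣q∣ (true ∷ p)  q = cong suc (∣p++q∣≡∣p∣+∣q∣ p q)
∣p++q∣≡∣p∣+∣q∣ (false ∷ p) q = ∣p++q∣≡∣p∣+∣q∣ p q

module _ (G : Graph) where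

  Dominating : Subset (n G) → Set
  Dominating A = ∀ v → InClosedNbhd G A v

  independent∧dominating⇒maximal : ∀ {A} → Independent G A → Dominating A → MaximalIndependent G A
  independent∧dominating⇒maximal {A} iA dom = iA , maximal
    where
    maximal : ∀ T → Independent G T → A ⊆ T → T ⊆ A
    maximal T iT A⊆T {v} v∈T with dom v
    ... | inj₁ v∈A              = v∈A
    ... | inj₂ (u , u∈A , u~v) = ⊥-elim (iT u v (A⊆T u∈A) v∈T u~v)

module _ (G : Graph) (Adj? : Decidable (Adj G)) where

  inClosedNbhd? : ∀ A v → Dec (InClosedNbhd G A v)
  inClosedNbhd? A v = (v ∈? A) ⊎-dec any? (λ u → (u ∈? A) ×-dec Adj? u v)

  module _ {A B : Subset (n G)} (iA : Independent G A) (iB : Independent G B)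
           (outside⊆B : ∀ v → ¬ InClosedNbhd G A v → v ∈ B) where

    undominated⇒isolatable : ∀ v → ¬ InClosedNbhd G A v → Isolatable G v
    undominated⇒isolatable v v∉N[A] = J , independent-J , λ x → isolated x , λ { refl → v∉N[J] }
      where
      InJ : Fin (n G) → Set
      InJ x = x ∈ A ⊎ (x ≢ v × ¬ InClosedNbhd G A x)

      InJ? : ∀ x → Dec (InJ x)
      InJ? x = (x ∈? A) ⊎-dec (¬? (x ≟ᶠ v) ×-dec ¬? (inClosedNbhd? A x))

      J : Subset (n G)
      J = fromDec InJ?

      independent-J : Independent G J
      independent-J x y x∈J y∈J = independent (∈-fromDec⁻ InJ? x∈J) (∈-fromDec⁻ InJ? y∈J)
        where
        independent : InJ x → InJ y → ¬ Adj G x y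
        independent (inj₁ x∈A)          (inj₁ y∈A)              = iA x y x∈A y∈A
        independent (inj₁ x∈A)          (inj₂ (_ , y∉N[A])) x~y = y∉N[A] (inj₂ (x , x∈A , x~y))
        independent (inj₂ (_ , x∉N[A])) (inj₁ y∈A)          x~y = x∉N[A] (inj₂ (y , y∈A , sym G x y x~y))
        independent (inj₂ (_ , x∉N[A])) (inj₂ (_ , y∉N[A]))     =
          iB x y (outside⊆B x x∉N[A]) (outside⊆B y y∉N[A])

      A⊆J : A ⊆ J
      A⊆J = ∈-fromDec⁺ InJ? ∘ inj₁

      N[A]⊆N[J] : ∀ {x} → InClosedNbhd G A x → InClosedNbhd G J x
      N[A]⊆N[J] (inj₁ x∈A)              = inj₁ (A⊆J x∈A)
      N[A]⊆N[J] (inj₂ (u , u∈A , u~x)) = inj₂ (u , A⊆J u∈A , u~x)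

      isolated : ∀ x → ¬ InClosedNbhd G J x → x ≡ v
      isolated x x∉N[J] = decidable-stable (x ≟ᶠ v) λ x≢v →
        x∉N[J] (inj₁ (∈-fromDec⁺ InJ? (inj₂ (x≢v , x∉N[J] ∘ N[A]⊆N[J]))))

      v∉N[J] : ¬ InClosedNbhd G J v
      v∉N[J] (inj₁ v∈J) with ∈-fromDec⁻ InJ? v∈J
      ... | inj₁ v∈A       = v∉N[A] (inj₁ v∈A)
      ... | inj₂ (v≢v , _) = v≢v refl
      v∉N[J] (inj₂ (u , u∈J , u~v)) with ∈-fromDec⁻ InJ? u∈J
      ... | inj₁ u∈A          = v∉N[A] (inj₂ (u , u∈A , u~v))
      ... | inj₂ (_ , u∉N[A]) = iB u v (outside⊆B u u∉N[A]) (outside⊆B v v∉N[A]) u~v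

    nonisolatable⇒dominating : (∀ w → ¬ Isolatable G w) → Dominating G A
    nonisolatable⇒dominating noIso v =
      decidable-stable (inClosedNbhd? A v) (noIso v ∘ undominated⇒isolatable v)

module _ (G : Graph) where

  private
    N = n G

  Layers : Subset N → Subset N → Fin N ⊎ Fin N → Set
  Layers A B = [ _∈ A , _∈ B ]′

  LayerIndependent : Subset N → Subset N → Set
  LayerIndependent A B = ∀ x y → Layers A B x → Layers A B y → ¬ ProdAdj′ G x y

  module _ {A B : Subset N} where

    ∈-++⁻ : ∀ {u} → u ∈ A ++ B → Layers A B (splitAt N u)
    ∈-++⁻ {u} u∈ = layer (splitAt N u) (trans (Eq.sym (lookup-splitAt N A B u)) ([]=⇒lookup u∈))
      where
      layer : ∀ x → [ lookup A , lookup B ]′ x ≡ true → Layers A B x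
      layer (inj₁ a) = lookup⇒[]= a A
      layer (inj₂ b) = lookup⇒[]= b B

    ∈-++⁺ : ∀ {u} → Layers A B (splitAt N u) → u ∈ A ++ B
    ∈-++⁺ {u} u∈ = lookup⇒[]= u (A ++ B) (trans (lookup-splitAt N A B u) (layer (splitAt N u) u∈))
      where
      layer : ∀ x → Layers A B x → [ lookup A , lookup B ]′ x ≡ true
      layer (inj₁ a) = []=⇒lookup
      layer (inj₂ b) = []=⇒lookup

    join-∈-++⁺ : ∀ x → Layers A B x → join N N x ∈ A ++ B
    join-∈-++⁺ x = ∈-++⁺ ∘ subst (Layers A B) (Eq.sym (splitAt-join N N x))

    join-∈-++⁻ : ∀ x → join N N x ∈ A ++ B → Layers A B x
    join-∈-++⁻ x = subst (Layers A B) (splitAt-join N N x) ∘ ∈-++⁻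

    independent-++⁺ : LayerIndependent A B → Independent (G □K₂) (A ++ B)
    independent-++⁺ li u v u∈ v∈ = li (splitAt N u) (splitAt N v) (∈-++⁻ u∈) (∈-++⁻ v∈)

    independent-++⁻ : Independent (G □K₂) (A ++ B) → LayerIndependent A B
    independent-++⁻ ind x y x∈ y∈ x~y =
      ind (join N N x) (join N N y) (join-∈-++⁺ x x∈) (join-∈-++⁺ y y∈)
        (subst₂ (ProdAdj′ G) (Eq.sym (splitAt-join N N x)) (Eq.sym (splitAt-join N N y)) x~y)

    layerIndependent⇒independentˡ : LayerIndependent A B → Independent G A
    layerIndependent⇒independentˡ li a a′ = li (inj₁ a) (inj₁ a′)

    layerIndependent⇒independentʳ : LayerIndependent A B → Independent G B
    layerIndependent⇒independentʳ li b b′ = li (inj₂ b) (inj₂ b′)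

    layerIndependent-swap : LayerIndependent A B → LayerIndependent B A
    layerIndependent-swap li x y x∈ y∈ = li (Sum.swap x) (Sum.swap y) (swapped x x∈) (swapped y y∈) ∘ adj x y
      where
      swapped : ∀ x → Layers B A x → Layers A B (Sum.swap x)
      swapped (inj₁ _) = id
      swapped (inj₂ _) = id
      adj : ∀ x y → ProdAdj′ G x y → ProdAdj′ G (Sum.swap x) (Sum.swap y)
      adj (inj₁ _) (inj₁ _) = id
      adj (inj₁ _) (inj₂ _) = id
      adj (inj₂ _) (inj₁ _) = id
      adj (inj₂ _) (inj₂ _) = id

  ++-⊆⁺ : ∀ {A B A′ B′} → A ⊆ A′ → B ⊆ B′ → A ++ B ⊆ A′ ++ B′
  ++-⊆⁺ {A} {B} {A′} {B′} A⊆A′ B⊆B′ {u} = ∈-++⁺ ∘ layers (splitAt N u) ∘ ∈-++⁻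
    where
    layers : ∀ x → Layers A B x → Layers A′ B′ x
    layers (inj₁ _) = A⊆A′
    layers (inj₂ _) = B⊆B′

  ++-⊆⁻ : ∀ {A B A′ B′} → A ++ B ⊆ A′ ++ B′ → A ⊆ A′ × B ⊆ B′
  ++-⊆⁻ {A} {B} {A′} {B′} sub = (λ {a} → layer (inj₁ a)) , (λ {b} → layer (inj₂ b))
    where
    layer : ∀ x → Layers A B x → Layers A′ B′ x
    layer x = join-∈-++⁻ x ∘ sub ∘ join-∈-++⁺ x

  insertˡ-layerIndependent : ∀ {A B v} → LayerIndependent A B → ¬ InClosedNbhd G A v → v ∉ B →
                             LayerIndependent (A ∪ ⁅ v ⁆) B
  insertˡ-layerIndependent {A} {B} {v} li v∉N[A] v∉B x y x∈ y∈ =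
    independent x y (old-or-new x x∈) (old-or-new y y∈)
    where
    new≁old : ∀ y → Layers A B y → ¬ ProdAdj′ G (inj₁ v) y
    new≁old (inj₁ a) a∈A v~a  = v∉N[A] (inj₂ (a , a∈A , sym G v a v~a))
    new≁old (inj₂ b) b∈B refl = v∉B b∈B
    independent : ∀ x y → Layers A B x ⊎ x ≡ inj₁ v → Layers A B y ⊎ y ≡ inj₁ v → ¬ ProdAdj′ G x y
    independent x y (inj₁ x∈′) (inj₁ y∈′) = li x y x∈′ y∈′
    independent _ y (inj₂ refl) (inj₁ y∈′) = new≁old y y∈′
    independent x _ (inj₁ x∈′) (inj₂ refl) = new≁old x x∈′ ∘ prodSym G x (inj₁ v)
    independent _ _ (inj₂ refl) (inj₂ refl) = prodIrrefl G (inj₁ v)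
    old-or-new : ∀ x → Layers (A ∪ ⁅ v ⁆) B x → Layers A B x ⊎ x ≡ inj₁ v
    old-or-new (inj₁ a) = Sum.map₂ (cong inj₁ ∘ x∈⁅y⁆⇒x≡y v) ∘ x∈p∪q⁻ A ⁅ v ⁆
    old-or-new (inj₂ b) = inj₁

  module _ {A B : Subset N} (mx : MaximalIndependent (G □K₂) (A ++ B)) where

    private
      li : LayerIndependent A B
      li = independent-++⁻ (proj₁ mx)

      enlarge : ∀ {A′ B′} → A ⊆ A′ → B ⊆ B′ → LayerIndependent A′ B′ → A′ ⊆ A × B′ ⊆ B
      enlarge {A′} {B′} A⊆A′ B⊆B′ li′ = ++-⊆⁻ (proj₂ mx (A′ ++ B′) (independent-++⁺ li′) (++-⊆⁺ A⊆A′ B⊆B′))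

      v∈p∪⁅v⁆ : ∀ {p : Subset N} v → v ∈ p ∪ ⁅ v ⁆
      v∈p∪⁅v⁆ v = x∈p∪q⁺ (inj₂ (x∈⁅x⁆ v))

    undominatedˡ⊆ʳ : ∀ v → ¬ InClosedNbhd G A v → v ∈ B
    undominatedˡ⊆ʳ v v∉N[A] = decidable-stable (v ∈? B) λ v∉B →
      v∉N[A] (inj₁ (proj₁ (enlarge (p⊆p∪q ⁅ v ⁆) id (insertˡ-layerIndependent li v∉N[A] v∉B)) (v∈p∪⁅v⁆ v)))

    undominatedʳ⊆ˡ : ∀ v → ¬ InClosedNbhd G B v → v ∈ A
    undominatedʳ⊆ˡ v v∉N[B] = decidable-stable (v ∈? A) λ v∉A →
      v∉N[B] (inj₁ (proj₂ (enlarge id (p⊆p∪q ⁅ v ⁆)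
        (layerIndependent-swap (insertˡ-layerIndependent (layerIndependent-swap li) v∉N[B] v∉A))) (v∈p∪⁅v⁆ v)))

    maximal-++⇒layersMaximal : Decidable (Adj G) → (∀ w → ¬ Isolatable G w) →
                     MaximalIndependent G A × MaximalIndependent G B
    maximal-++⇒layersMaximal Adj? noIso =
        independent∧dominating⇒maximal G iA (nonisolatable⇒dominating G Adj? iA iB undominatedˡ⊆ʳ noIso)
      , independent∧dominating⇒maximal G iB (nonisolatable⇒dominating G Adj? iB iA undominatedʳ⊆ˡ noIso)
      where
      iA = layerIndependent⇒independentˡ li
      iB = layerIndependent⇒independentʳ li

∣p∣≡∣take∣+∣drop∣ : ∀ m {k} (p : Subset (m + k)) → ∣ p ∣ ≡ ∣ take m p ∣ + ∣ drop m p ∣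
∣p∣≡∣take∣+∣drop∣ m p = trans (cong ∣_∣ (Eq.sym (take++drop≡id m p))) (∣p++q∣≡∣p∣+∣q∣ (take m p) (drop m p))

maximal⇒layersMaximal : ∀ G → Decidable (Adj G) → (∀ w → ¬ Isolatable G w) →
                        ∀ {S} → MaximalIndependent (G □K₂) S →
                        MaximalIndependent G (take (n G) S) × MaximalIndependent G (drop (n G) S)
maximal⇒layersMaximal G Adj? noIso {S} mS =
  maximal-++⇒layersMaximal G (subst (MaximalIndependent (G □K₂)) (Eq.sym (take++drop≡id (n G) S)) mS) Adj? noIso

theorem3p9 : (G : Graph) → WellCovered G → (∀ w → ¬ Isolatable G w) → WellCovered (G □K₂)
theorem3p9 G wc noIso S T mS mT =
  decidable-stable (∣ S ∣ ≟ ∣ T ∣) (¬¬-map sameSize (¬¬-decidable (Adj G)))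
  where
  open Eq.≡-Reasoning
  N = n G

  sameSize : Decidable (Adj G) → ∣ S ∣ ≡ ∣ T ∣
  sameSize Adj? = begin
    ∣ S ∣                       ≡⟨ ∣p∣≡∣take∣+∣drop∣ N S ⟩
    ∣ take N S ∣ + ∣ drop N S ∣ ≡⟨ cong₂ _+_ (wc _ _ (proj₁ mS′) (proj₁ mT′)) (wc _ _ (proj₂ mS′) (proj₂ mT′)) ⟩
    ∣ take N T ∣ + ∣ drop N T ∣ ≡⟨ Eq.sym (∣p∣≡∣take∣+∣drop∣ N T) ⟩
    ∣ T ∣                       ∎
    where
    mS′ = maximal⇒layersMaximal G Adj? noIso mS
    mT′ = maximal⇒layersMaximal G Adj? noIso mT
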